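{- $$\sum_{n=1}^{\infty}\frac{H_{n+1}^{(2)}+(H_{n+1})^2}{n(n+1)}=3!,\qquad \sum_{n=1}^{\infty}\frac{2H_{n+1}^{(3)}+3H_{n+1}H_{n+1}^{(2)}+(H_{n+1})^3}{n(n+1)}=4!.$$
   Context: For positive integers $\alpha$, $H_m^{(\alpha)}=\sum_{j=1}^{m}\frac{1}{j^\alpha}$ and $H_m=H_m^{(1)}$ is the $m$-th harmonic number. -}

module Defs where

open import Data.Nat using (ℕ; zero; suc; _≥_)
open import Data.Integer using (+_)
open import Data.Rational using (ℚ; 0ℚ; 1ℚ; _+_; _*_; _-_; _/_; ∣_∣; _<_; _≤_)
open import Data.Product using (∃)

_^ℚ_ : ℚ → ℕ → ℚ
q ^ℚ zero  = 1ℚ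
q ^ℚ suc k = q * (q ^ℚ k)

inv : ℕ → ℚ
inv i = + 1 / suc i

sumTo : ℕ → (ℕ → ℚ) → ℚ
sumTo zero    f = 0ℚ
sumTo (suc m) f = sumTo m f + f m

H^ : ℕ → ℕ → ℚ
H^ α m = sumTo m (λ i → (inv i) ^ℚ α)

H : ℕ → ℚ
H m = H^ 1 m

w : ℕ → ℚ
w k = inv k * inv (suc k)

-- terms of the two series, indexed by k = n - 1 ≥ 0 (n = k + 1)
term₁ : ℕ → ℚ
term₁ k = (H^ 2 (suc (suc k)) + H (suc (suc k)) ^ℚ 2) * w k

term₂ : ℕ → ℚ
term₂ k = ((+ 2 / 1) * H^ 3 (suc (suc k))
          + (+ 3 / 1) * H (suc (suc k)) * H^ 2 (suc (suc k))
          + H (suc (suc k)) ^ℚ 3) * w k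

partial : (ℕ → ℚ) → ℕ → ℚ
partial a N = sumTo N a

SeriesConvergesTo : (ℕ → ℚ) → ℚ → Set
SeriesConvergesTo a L =
  ∀ (ε : ℚ) → 0ℚ < ε → ∃ λ (N : ℕ) → ∀ (M : ℕ) → M ≥ N → ∣ partial a M - L ∣ < ε

-- Write c_j(m) for the complete homogeneous symmetric sum of degree j of 1, 1/2, …, 1/m.
-- The numerator of the r-th series (r = 1, 2) is N_r(n+1), where N_r = (r+1)! c_{r+1} is
-- written through the power sums H, H⁽²⁾, H⁽³⁾. Adjoining 1/(m+1) gives
-- c_j(m+1) = c_j(m) + c_{j-1}(m+1)/(m+1), so P_r = (r+1)! (c₀ + … + c_{r+1}) satisfies
-- P_r(m+1) − P_r(m) = (P_r − N_r)(m+1)/(m+1). Together with 1/(n(n+1)) = 1/n − 1/(n+1) this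
-- makes P_r(n)/n the exact tail of the series from its n-th term on, so the sum is
-- P_r(1) = (r+1)! (r+2) = (r+2)!. The tails tend to 0 because they are at most
-- 6 (1 + H_n)³/n while (1 + H_n)⁴ ≤ 512 n.
module Submission where

open import Data.Empty using (⊥-elim)
open import Data.Integer as ℤ using (+_; +[1+_])
import Data.Integer.Properties as ℤ
import Data.Integer.Tactic.RingSolver as ℤ
open import Data.Nat as ℕ using (ℕ; zero; suc; _!; s≤s; z≤n)
open import Data.Product using (_×_; _,_; ∃; proj₁; proj₂)
open import Data.Sum using (inj₁; inj₂)
open import Level using (0ℓ)
open import Data.Rational
open import Data.Rational.Properties
import Data.Rational.Unnormalised as ℚᵘ
import Data.Rational.Unnormalised.Properties as ℚᵘ
open import Relation.Binary.PropositionalEquality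
open import Relation.Nullary using (yes; no)
open import Relation.Nullary.Decidable using (dec⇒maybe)
open import Tactic.RingSolver using (solve-∀)
open import Tactic.RingSolver.Core.AlmostCommutativeRing using (AlmostCommutativeRing; fromCommutativeRing)

open import Defs

ℚ-ring : AlmostCommutativeRing 0ℓ 0ℓ
ℚ-ring = fromCommutativeRing +-*-commutativeRing (λ p → dec⇒maybe (0ℚ ≟ p))

-- Powers are taken in ℚ-ring so that the ring solver recognises them. The solver unfolds
-- no other definition, so _^ℚ_ (v ^ℚ 2 = v * (v * 1ℚ)) and the polynomials P₁, N₁, …
-- below are spelled out in its goals.
open AlmostCommutativeRing ℚ-ring using (_^_)

fromℕ : ℕ → ℚ
fromℕ n = + n / 1

toℚᵘ-fromℕ : ∀ n → toℚᵘ (fromℕ n) ℚᵘ.≃ ℚᵘ.mkℚᵘ (+ n) 0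
toℚᵘ-fromℕ n = toℚᵘ-fromℚᵘ (ℚᵘ.mkℚᵘ (+ n) 0)

toℚᵘ-inv : ∀ k → toℚᵘ (inv k) ℚᵘ.≃ ℚᵘ.mkℚᵘ (+ 1) k
toℚᵘ-inv k = toℚᵘ-fromℚᵘ (ℚᵘ.mkℚᵘ (+ 1) k)

fromℕ-suc : ∀ n → fromℕ (suc n) ≡ 1ℚ + fromℕ n
fromℕ-suc n = toℚᵘ-injective (begin
  toℚᵘ (fromℕ (suc n))                  ≈⟨ toℚᵘ-fromℕ (suc n) ⟩
  ℚᵘ.mkℚᵘ (+ suc n) 0                   ≈⟨ ℚᵘ.*≡* (identity (+ 1) (+ n)) ⟩
  ℚᵘ.1ℚᵘ ℚᵘ.+ ℚᵘ.mkℚᵘ (+ n) 0           ≈⟨ ℚᵘ.+-cong ℚᵘ.≃-refl (toℚᵘ-fromℕ n) ⟨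
  toℚᵘ 1ℚ ℚᵘ.+ toℚᵘ (fromℕ n)          ≈⟨ toℚᵘ-homo-+ 1ℚ (fromℕ n) ⟨
  toℚᵘ (1ℚ + fromℕ n)                   ∎)
  where
  open ℚᵘ.≃-Reasoning
  identity : ∀ x y → (x ℤ.+ y) ℤ.* + 1 ≡ (x ℤ.* + 1 ℤ.+ y ℤ.* + 1) ℤ.* + 1
  identity = ℤ.solve-∀

inv-*-fromℕ : ∀ k → inv k * fromℕ (suc k) ≡ 1ℚ
inv-*-fromℕ k = toℚᵘ-injective (begin
  toℚᵘ (inv k * fromℕ (suc k))                 ≈⟨ toℚᵘ-homo-* (inv k) (fromℕ (suc k)) ⟩
  toℚᵘ (inv k) ℚᵘ.* toℚᵘ (fromℕ (suc k))       ≈⟨ ℚᵘ.*-cong (toℚᵘ-inv k) (toℚᵘ-fromℕ (suc k)) ⟩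
  ℚᵘ.mkℚᵘ (+ 1) k ℚᵘ.* ℚᵘ.mkℚᵘ (+ suc k) 0     ≈⟨ ℚᵘ.*≡* (identity (+ suc k)) ⟩
  ℚᵘ.1ℚᵘ                                       ∎)
  where
  open ℚᵘ.≃-Reasoning
  identity : ∀ x → (+ 1 ℤ.* x) ℤ.* + 1 ≡ + 1 ℤ.* (x ℤ.* + 1)
  identity = ℤ.solve-∀

inv-*-1+fromℕ : ∀ k → inv (suc k) * (1ℚ + fromℕ (suc k)) ≡ 1ℚ
inv-*-1+fromℕ k = trans (cong (inv (suc k) *_) (sym (fromℕ-suc (suc k)))) (inv-*-fromℕ (suc k))

inv-partialFraction : ∀ k → inv k * inv (suc k) ≡ inv k - inv (suc k)
inv-partialFraction k = begin
  u * v                              ≡⟨ identity u v a ⟩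
  u * (v * (1ℚ + a)) - v * (u * a)   ≡⟨ cong₂ (λ s t → u * s - v * t) (inv-*-1+fromℕ k) (inv-*-fromℕ k) ⟩
  u * 1ℚ - v * 1ℚ                    ≡⟨ cong₂ _-_ (*-identityʳ u) (*-identityʳ v) ⟩
  u - v                              ∎
  where
  open ≡-Reasoning
  u v a : ℚ
  u = inv k
  v = inv (suc k)
  a = fromℕ (suc k)
  identity : ∀ u v a → u * v ≡ u * (v * (1ℚ + a)) - v * (u * a)
  identity = solve-∀ ℚ-ring

inv-antitone : ∀ {m n} → m ℕ.≤ n → inv n ≤ inv m
inv-antitone {m} {n} m≤n = toℚᵘ-cancel-≤
  (ℚᵘ.≤-respʳ-≃ (ℚᵘ.≃-sym (toℚᵘ-inv m)) (ℚᵘ.≤-respˡ-≃ (ℚᵘ.≃-sym (toℚᵘ-inv n))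
    (ℚᵘ.*≤* (ℤ.*-monoˡ-≤-nonNeg (+ 1) (ℤ.+≤+ (s≤s m≤n))))))

inv-antitone-< : ∀ {m n} → m ℕ.< n → inv n < inv m
inv-antitone-< {m} {n} m<n = toℚᵘ-cancel-<
  (ℚᵘ.<-respʳ-≃ (ℚᵘ.≃-sym (toℚᵘ-inv m)) (ℚᵘ.<-respˡ-≃ (ℚᵘ.≃-sym (toℚᵘ-inv n))
    (ℚᵘ.*<* (ℤ.*-monoˡ-<-pos (+ 1) (ℤ.+<+ {suc m} {suc n} (s≤s m<n))))))

inv-archimedean : ∀ ε → Positive ε → ∃ λ q → inv q ≤ ε
inv-archimedean (mkℚ +[1+ p ] q _) _ = q , toℚᵘ-cancel-≤
  (ℚᵘ.≤-respˡ-≃ (ℚᵘ.≃-sym (toℚᵘ-inv q)) (ℚᵘ.*≤* (ℤ.*-monoʳ-≤-nonNeg (+ suc q) (ℤ.+≤+ {1} {suc p} (s≤s z≤n)))))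

0≤fromℕ : ∀ n → 0ℚ ≤ fromℕ n
0≤fromℕ n = nonNegative⁻¹ (fromℕ n) {{normalize-nonNeg n 1}}

0≤inv : ∀ k → 0ℚ ≤ inv k
0≤inv k = nonNegative⁻¹ (inv k) {{normalize-nonNeg 1 (suc k)}}

inv≤1 : ∀ k → inv k ≤ 1ℚ
inv≤1 k = inv-antitone {0} {k} z≤n

≤-by-gap : ∀ {p q} s → 0ℚ ≤ s → p + s ≡ q → p ≤ q
≤-by-gap {p} s 0≤s p+s≡q = subst₂ _≤_ (+-identityʳ p) p+s≡q (+-monoʳ-≤ p 0≤s)

p≤q⇒0≤q-p : ∀ {p q} → p ≤ q → 0ℚ ≤ q - p
p≤q⇒0≤q-p {p} {q} p≤q = subst (_≤ q - p) (+-inverseʳ p) (+-monoˡ-≤ (- p) p≤q)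

0≤+ : ∀ {p q} → 0ℚ ≤ p → 0ℚ ≤ q → 0ℚ ≤ p + q
0≤+ = +-mono-≤

0≤* : ∀ {p q} → 0ℚ ≤ p → 0ℚ ≤ q → 0ℚ ≤ p * q
0≤* {p} {q} 0≤p 0≤q = subst (_≤ p * q) (*-zeroʳ p) (*-monoˡ-≤-nonNeg p {{nonNegative 0≤p}} 0≤q)

0<* : ∀ {p q} → 0ℚ < p → 0ℚ < q → 0ℚ < p * q
0<* {p} {q} 0<p 0<q = subst (_< p * q) (*-zeroʳ p) (*-monoʳ-<-pos p {{positive 0<p}} 0<q)

*-mono-≤-nonNeg : ∀ {p q r s} → 0ℚ ≤ p → 0ℚ ≤ r → p ≤ q → r ≤ s → p * r ≤ q * s
*-mono-≤-nonNeg {p} {q} {r} {s} 0≤p 0≤r p≤q r≤s = ≤-trans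
  (*-monoʳ-≤-nonNeg r {{nonNegative 0≤r}} p≤q)
  (*-monoˡ-≤-nonNeg q {{nonNegative (≤-trans 0≤p p≤q)}} r≤s)

0≤p² : ∀ p → 0ℚ ≤ p ^ 2
0≤p² p with ≤-total 0ℚ p
... | inj₁ 0≤p = 0≤* 0≤p 0≤p
... | inj₂ p≤0 = subst (0ℚ ≤_) (neg-square p) (0≤* 0≤-p 0≤-p)
  where
  0≤-p : 0ℚ ≤ - p
  0≤-p = neg-antimono-≤ p≤0
  neg-square : ∀ p → (- p) * (- p) ≡ p ^ 2
  neg-square = solve-∀ ℚ-ring

0≤^ : ∀ n {p} → 0ℚ ≤ p → 0ℚ ≤ p ^ n
0≤^ zero          0≤p = ≤ᵇ⇒≤ _
0≤^ (suc zero)    0≤p = 0≤p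
0≤^ (suc (suc n)) 0≤p = 0≤* (0≤^ (suc n) 0≤p) 0≤p

0<^ : ∀ n {p} → 0ℚ < p → 0ℚ < p ^ n
0<^ zero          0<p = positive⁻¹ 1ℚ
0<^ (suc zero)    0<p = 0<p
0<^ (suc (suc n)) 0<p = 0<* (0<^ (suc n) 0<p) 0<p

^-monoˡ-≤-nonNeg : ∀ n {p q} → 0ℚ ≤ p → p ≤ q → p ^ n ≤ q ^ n
^-monoˡ-≤-nonNeg zero          0≤p p≤q = ≤-refl
^-monoˡ-≤-nonNeg (suc zero)    0≤p p≤q = p≤q
^-monoˡ-≤-nonNeg (suc (suc n)) 0≤p p≤q =
  *-mono-≤-nonNeg (0≤^ (suc n) 0≤p) 0≤p (^-monoˡ-≤-nonNeg (suc n) 0≤p p≤q) p≤q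

^-cancelˡ-<-nonNeg : ∀ n {p q} → 0ℚ ≤ q → p ^ n < q ^ n → p < q
^-cancelˡ-<-nonNeg n {p} {q} 0≤q pⁿ<qⁿ with p <? q
... | yes p<q = p<q
... | no  p≮q = ⊥-elim (<-irrefl refl (<-≤-trans pⁿ<qⁿ (^-monoˡ-≤-nonNeg n 0≤q (≮⇒≥ p≮q))))

0≤^ℚ : ∀ {p} → 0ℚ ≤ p → ∀ n → 0ℚ ≤ p ^ℚ n
0≤^ℚ 0≤p zero    = ≤ᵇ⇒≤ _
0≤^ℚ 0≤p (suc n) = 0≤* 0≤p (0≤^ℚ 0≤p n)

^ℚ≤1 : ∀ {p} → 0ℚ ≤ p → p ≤ 1ℚ → ∀ n → p ^ℚ n ≤ 1ℚ
^ℚ≤1 0≤p p≤1 zero    = ≤-refl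
^ℚ≤1 0≤p p≤1 (suc n) = *-mono-≤-nonNeg 0≤p (0≤^ℚ 0≤p n) p≤1 (^ℚ≤1 0≤p p≤1 n)

^ℚ-suc≤ : ∀ {p} → 0ℚ ≤ p → p ≤ 1ℚ → ∀ n → p ^ℚ suc n ≤ p
^ℚ-suc≤ {p} 0≤p p≤1 n = subst (p * p ^ℚ n ≤_) (*-identityʳ p)
  (*-monoˡ-≤-nonNeg p {{nonNegative 0≤p}} (^ℚ≤1 0≤p p≤1 n))

sumTo-mono-≤ : ∀ {f g : ℕ → ℚ} → (∀ i → f i ≤ g i) → ∀ m → sumTo m f ≤ sumTo m g
sumTo-mono-≤ f≤g zero    = ≤-refl
sumTo-mono-≤ f≤g (suc m) = +-mono-≤ (sumTo-mono-≤ f≤g m) (f≤g m)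

sumTo-nonNeg : ∀ {f : ℕ → ℚ} → (∀ i → 0ℚ ≤ f i) → ∀ m → 0ℚ ≤ sumTo m f
sumTo-nonNeg 0≤f zero    = ≤-refl
sumTo-nonNeg 0≤f (suc m) = 0≤+ (sumTo-nonNeg 0≤f m) (0≤f m)

H^-nonNeg : ∀ α m → 0ℚ ≤ H^ α m
H^-nonNeg α = sumTo-nonNeg (λ i → 0≤^ℚ (0≤inv i) α)

H^-suc≤H : ∀ α m → H^ (suc α) m ≤ H m
H^-suc≤H α = sumTo-mono-≤ λ i →
  subst (inv i ^ℚ suc α ≤_) (sym (*-identityʳ (inv i))) (^ℚ-suc≤ (0≤inv i) (inv≤1 i) α)

telescoping-step : ∀ {u v N P P′} → u * v ≡ u - v → P′ - P ≡ v * (P′ - N) →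
                   N * (u * v) + P′ * v ≡ P * u
telescoping-step {u} {v} {N} {P} {P′} uv≡u-v ΔP = begin
  N * (u * v) + P′ * v          ≡⟨ cong (λ t → N * t + P′ * v) uv≡u-v ⟩
  N * (u - v) + P′ * v          ≡⟨ regroup u v N P′ ⟩
  P′ * u - (u - v) * (P′ - N)   ≡⟨ cong (λ t → P′ * u - t * (P′ - N)) uv≡u-v ⟨
  P′ * u - (u * v) * (P′ - N)   ≡⟨ cong (λ t → P′ * u - t) (*-assoc u v (P′ - N)) ⟩
  P′ * u - u * (v * (P′ - N))   ≡⟨ cong (λ t → P′ * u - u * t) ΔP ⟨
  P′ * u - u * (P′ - P)         ≡⟨ cancel u P P′ ⟩
  P * u                         ∎
  where
  open ≡-Reasoning
  regroup : ∀ u v N P′ → N * (u - v) + P′ * v ≡ P′ * u - (u - v) * (P′ - N)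
  regroup = solve-∀ ℚ-ring
  cancel : ∀ u P P′ → P′ * u - u * (P′ - P) ≡ P * u
  cancel = solve-∀ ℚ-ring

sumTo-telescope : ∀ {a R : ℕ → ℚ} → (∀ k → a k + R (suc k) ≡ R k) → ∀ m → sumTo m a + R m ≡ R 0
sumTo-telescope         step zero    = +-identityˡ _
sumTo-telescope {a} {R} step (suc m) = begin
  sumTo m a + a m + R (suc m)    ≡⟨ +-assoc (sumTo m a) (a m) (R (suc m)) ⟩
  sumTo m a + (a m + R (suc m))  ≡⟨ cong (λ t → sumTo m a + t) (step m) ⟩
  sumTo m a + R m                ≡⟨ sumTo-telescope step m ⟩
  R 0                            ∎
  where open ≡-Reasoning

IsNull : (ℕ → ℚ) → Set
IsNull R = ∀ ε → 0ℚ < ε → ∃ λ N → ∀ M → M ℕ.≥ N → R M < ε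

IsNull-≤ : ∀ {R B : ℕ → ℚ} → (∀ k → R k ≤ B k) → IsNull B → IsNull R
IsNull-≤ R≤B null ε 0<ε with null ε 0<ε
... | N , B<ε = N , λ M M≥N → ≤-<-trans (R≤B M) (B<ε M M≥N)

IsNull-of-^-bound : ∀ {B : ℕ → ℚ} n K .{{_ : Positive K}} → (∀ k → B k ^ n ≤ K * inv k) → IsNull B
IsNull-of-^-bound {B} n K Bⁿ≤K/k ε 0<ε = suc q , λ M q<M → ^-cancelˡ-<-nonNeg n (<⇒≤ 0<ε) (begin-strict
  B M ^ n     ≤⟨ Bⁿ≤K/k M ⟩
  K * inv M   <⟨ *-monoʳ-<-pos K (inv-antitone-< q<M) ⟩
  K * inv q   ≤⟨ *-monoˡ-≤-nonNeg K {{pos⇒nonNeg K}} inv-q≤δ ⟩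
  K * δ       ≡⟨ K*δ≡εⁿ ⟩
  ε ^ n       ∎)
  where
  open ≤-Reasoning
  instance
    K≢0 : NonZero K
    K≢0 = pos⇒nonZero K
  δ : ℚ
  δ = ε ^ n ÷ K
  0<δ : 0ℚ < δ
  0<δ = 0<* (0<^ n 0<ε) (positive⁻¹ (1/ K) {{1/pos⇒pos K}})
  archimedes : ∃ λ q → inv q ≤ δ
  archimedes = inv-archimedean δ (positive 0<δ)
  q : ℕ
  q = proj₁ archimedes
  inv-q≤δ : inv q ≤ δ
  inv-q≤δ = proj₂ archimedes
  K*δ≡εⁿ : K * δ ≡ ε ^ n
  K*δ≡εⁿ = begin-equality
    K * (ε ^ n * 1/ K)   ≡⟨ swap K (ε ^ n) (1/ K) ⟩
    ε ^ n * (K * 1/ K)   ≡⟨ cong (ε ^ n *_) (*-inverseʳ K) ⟩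
    ε ^ n * 1ℚ           ≡⟨ *-identityʳ (ε ^ n) ⟩
    ε ^ n                ∎
    where
    swap : ∀ a b c → a * (b * c) ≡ b * (a * c)
    swap = solve-∀ ℚ-ring

series-converges-of-tail : ∀ {a R : ℕ → ℚ} → (∀ k → a k + R (suc k) ≡ R k) → (∀ k → 0ℚ ≤ R k) →
                           IsNull R → SeriesConvergesTo a (R 0)
series-converges-of-tail {a} {R} step 0≤R null ε 0<ε with null ε 0<ε
... | N , R<ε = N , λ M M≥N → subst (_< ε) (sym (distance M)) (R<ε M M≥N)
  where
  distance : ∀ M → ∣ partial a M - R 0 ∣ ≡ R M
  distance M = begin
    ∣ partial a M - R 0 ∣                  ≡⟨ cong (λ t → ∣ partial a M - t ∣) (sumTo-telescope step M) ⟨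
    ∣ partial a M - (partial a M + R M) ∣  ≡⟨ cong ∣_∣ (difference (partial a M) (R M)) ⟩
    ∣ - R M ∣                              ≡⟨ ∣-p∣≡∣p∣ (R M) ⟩
    ∣ R M ∣                                ≡⟨ 0≤p⇒∣p∣≡p (0≤R M) ⟩
    R M                                    ∎
    where
    open ≡-Reasoning
    difference : ∀ p r → p - (p + r) ≡ - r
    difference = solve-∀ ℚ-ring

N₁ : ℚ → ℚ → ℚ
N₁ h h₂ = h₂ + h ^ℚ 2

N₂ : ℚ → ℚ → ℚ → ℚ
N₂ h h₂ h₃ = (+ 2 / 1) * h₃ + (+ 3 / 1) * h * h₂ + h ^ℚ 3

P₁ : ℚ → ℚ → ℚ
P₁ h h₂ = + 2 / 1 * (1ℚ + h) + N₁ h h₂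

P₂ : ℚ → ℚ → ℚ → ℚ
P₂ h h₂ h₃ = + 3 / 1 * P₁ h h₂ + N₂ h h₂ h₃

P₁-increment : ∀ h h₂ v → let h′ = h + v ^ℚ 1; h₂′ = h₂ + v ^ℚ 2 in
               P₁ h′ h₂′ - P₁ h h₂ ≡ v * (P₁ h′ h₂′ - N₁ h′ h₂′)
P₁-increment = identity
  where
  identity : ∀ h h₂ v →
    let n₁ = λ h h₂ → h₂ + h * (h * 1ℚ)
        p₁ = λ h h₂ → + 2 / 1 * (1ℚ + h) + n₁ h h₂
        h′ = h + v * 1ℚ; h₂′ = h₂ + v * (v * 1ℚ)
    in p₁ h′ h₂′ - p₁ h h₂ ≡ v * (p₁ h′ h₂′ - n₁ h′ h₂′)
  identity = solve-∀ ℚ-ring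

P₂-increment : ∀ h h₂ h₃ v → let h′ = h + v ^ℚ 1; h₂′ = h₂ + v ^ℚ 2; h₃′ = h₃ + v ^ℚ 3 in
               P₂ h′ h₂′ h₃′ - P₂ h h₂ h₃ ≡ v * (P₂ h′ h₂′ h₃′ - N₂ h′ h₂′ h₃′)
P₂-increment = identity
  where
  identity : ∀ h h₂ h₃ v →
    let n₁ = λ h h₂ → h₂ + h * (h * 1ℚ)
        n₂ = λ h h₂ h₃ → (+ 2 / 1) * h₃ + (+ 3 / 1) * h * h₂ + h * (h * (h * 1ℚ))
        p₂ = λ h h₂ h₃ → + 3 / 1 * (+ 2 / 1 * (1ℚ + h) + n₁ h h₂) + n₂ h h₂ h₃
        h′ = h + v * 1ℚ; h₂′ = h₂ + v * (v * 1ℚ); h₃′ = h₃ + v * (v * (v * 1ℚ))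
    in p₂ h′ h₂′ h₃′ - p₂ h h₂ h₃ ≡ v * (p₂ h′ h₂′ h₃′ - n₂ h′ h₂′ h₃′)
  identity = solve-∀ ℚ-ring

tail₁ : ℕ → ℚ
tail₁ k = P₁ (H (suc k)) (H^ 2 (suc k)) * inv k

tail₂ : ℕ → ℚ
tail₂ k = P₂ (H (suc k)) (H^ 2 (suc k)) (H^ 3 (suc k)) * inv k

tail₁-step : ∀ k → term₁ k + tail₁ (suc k) ≡ tail₁ k
tail₁-step k = telescoping-step {inv k} {inv (suc k)} {N₁ h′ h₂′} {P₁ h h₂} {P₁ h′ h₂′}
  (inv-partialFraction k) (P₁-increment h h₂ (inv (suc k)))
  where
  h h₂ h′ h₂′ : ℚ
  h = H (suc k); h₂ = H^ 2 (suc k); h′ = H (suc (suc k)); h₂′ = H^ 2 (suc (suc k))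

tail₂-step : ∀ k → term₂ k + tail₂ (suc k) ≡ tail₂ k
tail₂-step k = telescoping-step {inv k} {inv (suc k)} {N₂ h′ h₂′ h₃′} {P₂ h h₂ h₃} {P₂ h′ h₂′ h₃′}
  (inv-partialFraction k) (P₂-increment h h₂ h₃ (inv (suc k)))
  where
  h h₂ h₃ h′ h₂′ h₃′ : ℚ
  h = H (suc k); h₂ = H^ 2 (suc k); h₃ = H^ 3 (suc k)
  h′ = H (suc (suc k)); h₂′ = H^ 2 (suc (suc k)); h₃′ = H^ 3 (suc (suc k))

0≤P₁ : ∀ {h h₂} → 0ℚ ≤ h → 0ℚ ≤ h₂ → 0ℚ ≤ P₁ h h₂
0≤P₁ 0≤h 0≤h₂ = 0≤+ (0≤* (0≤fromℕ 2) (0≤+ (0≤fromℕ 1) 0≤h)) (0≤+ 0≤h₂ (0≤^ℚ 0≤h 2))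

P₁≤P₂ : ∀ {h h₂ h₃} → 0ℚ ≤ h → 0ℚ ≤ h₂ → 0ℚ ≤ h₃ → P₁ h h₂ ≤ P₂ h h₂ h₃
P₁≤P₂ {h} {h₂} {h₃} 0≤h 0≤h₂ 0≤h₃ = ≤-by-gap (+ 2 / 1 * P₁ h h₂ + N₂ h h₂ h₃)
  (0≤+ (0≤* (0≤fromℕ 2) (0≤P₁ 0≤h 0≤h₂)) 0≤N₂) (identity (P₁ h h₂) (N₂ h h₂ h₃))
  where
  0≤N₂ : 0ℚ ≤ N₂ h h₂ h₃
  0≤N₂ = 0≤+ (0≤+ (0≤* (0≤fromℕ 2) 0≤h₃) (0≤* (0≤* (0≤fromℕ 3) 0≤h) 0≤h₂)) (0≤^ℚ 0≤h 3)
  identity : ∀ p n → p + (+ 2 / 1 * p + n) ≡ + 3 / 1 * p + n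
  identity = solve-∀ ℚ-ring

P₂≤6[1+h]³ : ∀ {h h₂ h₃} → 0ℚ ≤ h → h₂ ≤ h → h₃ ≤ h → P₂ h h₂ h₃ ≤ + 6 / 1 * (1ℚ + h) ^ 3
P₂≤6[1+h]³ {h} {h₂} {h₃} 0≤h h₂≤h h₃≤h = ≤-by-gap _
  (0≤+ (0≤+ (0≤+ (0≤+ (0≤+ (0≤* (0≤fromℕ 3) (p≤q⇒0≤q-p h₂≤h))
    (0≤* (0≤* (0≤fromℕ 3) 0≤h) (p≤q⇒0≤q-p h₂≤h))) (0≤* (0≤fromℕ 2) (p≤q⇒0≤q-p h₃≤h)))
    (0≤* (0≤fromℕ 7) 0≤h)) (0≤* (0≤fromℕ 12) (0≤^ 2 0≤h))) (0≤* (0≤fromℕ 5) (0≤^ 3 0≤h)))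
  (identity h h₂ h₃)
  where
  identity : ∀ h h₂ h₃ →
    let n₁ = h₂ + h * (h * 1ℚ)
        n₂ = (+ 2 / 1) * h₃ + (+ 3 / 1) * h * h₂ + h * (h * (h * 1ℚ))
    in (+ 3 / 1 * (+ 2 / 1 * (1ℚ + h) + n₁) + n₂)
       + (+ 3 / 1 * (h - h₂) + + 3 / 1 * h * (h - h₂) + + 2 / 1 * (h - h₃)
          + + 7 / 1 * h + + 12 / 1 * h ^ 2 + + 5 / 1 * h ^ 3)
       ≡ + 6 / 1 * (1ℚ + h) ^ 3
  identity = solve-∀ ℚ-ring

majorant : ℕ → ℚ
majorant k = + 6 / 1 * (1ℚ + H (suc k)) ^ 3 * inv k

0≤tail₁ : ∀ k → 0ℚ ≤ tail₁ k
0≤tail₁ k = 0≤* (0≤P₁ (H^-nonNeg 1 (suc k)) (H^-nonNeg 2 (suc k))) (0≤inv k)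

tail₁≤tail₂ : ∀ k → tail₁ k ≤ tail₂ k
tail₁≤tail₂ k = *-monoʳ-≤-nonNeg (inv k) {{nonNegative (0≤inv k)}}
  (P₁≤P₂ (H^-nonNeg 1 (suc k)) (H^-nonNeg 2 (suc k)) (H^-nonNeg 3 (suc k)))

0≤tail₂ : ∀ k → 0ℚ ≤ tail₂ k
0≤tail₂ k = ≤-trans (0≤tail₁ k) (tail₁≤tail₂ k)

tail₂≤majorant : ∀ k → tail₂ k ≤ majorant k
tail₂≤majorant k = *-monoʳ-≤-nonNeg (inv k) {{nonNegative (0≤inv k)}}
  (P₂≤6[1+h]³ (H^-nonNeg 1 (suc k)) (H^-suc≤H 1 (suc k)) (H^-suc≤H 2 (suc k)))

-- The gap is x⁴ + 283 − (4x³ + 6x²d + 4xd² + d³) as a sum of nonnegative terms; the cubic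
-- term is absorbed by ½ (x − 6)² ((x + 2)² + 8) = x⁴/2 − 4x³ + 216.
fourth-power-increment : ∀ {x d} → 0ℚ ≤ x → 0ℚ ≤ d → d ≤ 1ℚ →
                         (x + d) ^ 4 ≤ x ^ 4 + d * (x ^ 4 + + 283 / 1)
fourth-power-increment {x} {d} 0≤x 0≤d d≤1 = ≤-by-gap _
  (0≤* 0≤d (0≤+ (0≤+ (0≤+ (0≤+ (0≤+ (0≤+
    (0≤* (0≤^ 4 0≤x) 0≤¼)
    (0≤* (0≤* 0≤½ (0≤p² (x - + 6 / 1))) (0≤+ (0≤p² (x + + 2 / 1)) (0≤fromℕ 8))))
    (0≤* 0≤¼ (0≤p² (x ^ 2 - + 16 / 1))))
    (0≤* (0≤fromℕ 2) (0≤p² (x - 1ℚ))))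
    (0≤* (0≤* (0≤fromℕ 6) (0≤p² x)) 0≤1-d))
    (0≤* (0≤* (0≤* (0≤fromℕ 4) 0≤x) 0≤1-d) (0≤+ (0≤fromℕ 1) 0≤d)))
    (0≤* 0≤1-d (0≤+ (0≤+ (0≤fromℕ 1) 0≤d) (0≤p² d)))))
  (identity x d)
  where
  0≤¼ : 0ℚ ≤ + 1 / 4
  0≤¼ = ≤ᵇ⇒≤ _
  0≤½ : 0ℚ ≤ ½
  0≤½ = ≤ᵇ⇒≤ _
  0≤1-d : 0ℚ ≤ 1ℚ - d
  0≤1-d = p≤q⇒0≤q-p d≤1
  identity : ∀ x d →
    (x + d) ^ 4
    + d * (x ^ 4 * (+ 1 / 4) + ½ * (x - + 6 / 1) ^ 2 * ((x + + 2 / 1) ^ 2 + + 8 / 1)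
           + + 1 / 4 * (x ^ 2 - + 16 / 1) ^ 2 + + 2 / 1 * (x - 1ℚ) ^ 2
           + + 6 / 1 * x ^ 2 * (1ℚ - d) + + 4 / 1 * x * (1ℚ - d) * (1ℚ + d)
           + (1ℚ - d) * (1ℚ + d + d ^ 2))
    ≡ x ^ 4 + d * (x ^ 4 + + 283 / 1)
  identity = solve-∀ ℚ-ring

fourth-power-growth-step : ∀ {C x d e} → + 283 / 1 ≤ C → 0ℚ ≤ x → 0ℚ ≤ d → d ≤ 1ℚ →
                           x ^ 4 ≤ C * e → d * (1ℚ + e) ≡ 1ℚ → (x + d) ^ 4 ≤ C * (1ℚ + e)
fourth-power-growth-step {C} {x} {d} {e} 283≤C 0≤x 0≤d d≤1 x⁴≤Ce d[1+e]≡1 = begin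
  (x + d) ^ 4                       ≤⟨ fourth-power-increment 0≤x 0≤d d≤1 ⟩
  x ^ 4 + d * (x ^ 4 + + 283 / 1)   ≤⟨ +-mono-≤ x⁴≤Ce
                                         (*-monoˡ-≤-nonNeg d {{nonNegative 0≤d}} (+-mono-≤ x⁴≤Ce 283≤C)) ⟩
  C * e + d * (C * e + C)           ≡⟨ regroup C d e ⟩
  C * e + C * (d * (1ℚ + e))        ≡⟨ cong (λ t → C * e + C * t) d[1+e]≡1 ⟩
  C * e + C * 1ℚ                    ≡⟨ factor C e ⟩
  C * (1ℚ + e)                      ∎
  where
  open ≤-Reasoning
  regroup : ∀ C d e → C * e + d * (C * e + C) ≡ C * e + C * (d * (1ℚ + e))
  regroup = solve-∀ ℚ-ring
  factor : ∀ C e → C * e + C * 1ℚ ≡ C * (1ℚ + e)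
  factor = solve-∀ ℚ-ring

[1+H]⁴≤512n : ∀ k → (1ℚ + H (suc k)) ^ 4 ≤ + 512 / 1 * fromℕ (suc k)
[1+H]⁴≤512n zero    = ≤ᵇ⇒≤ _
[1+H]⁴≤512n (suc k) = subst₂ _≤_
  (cong (_^ 4) (sym (shift (H (suc k)) (inv (suc k)))))
  (cong (λ t → + 512 / 1 * t) (sym (fromℕ-suc (suc k))))
  (fourth-power-growth-step {+ 512 / 1} {e = fromℕ (suc k)} (≤ᵇ⇒≤ _)
    (0≤+ (0≤fromℕ 1) (H^-nonNeg 1 (suc k))) (0≤inv (suc k)) (inv≤1 (suc k))
    ([1+H]⁴≤512n k) (inv-*-1+fromℕ k))
  where
  shift : ∀ h v → 1ℚ + (h + v * 1ℚ) ≡ 1ℚ + h + v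
  shift = solve-∀ ℚ-ring

majorant⁴≤ : ∀ k → majorant k ^ 4 ≤ + 1296 / 1 * (+ 512 / 1) ^ 3 * inv k
majorant⁴≤ k = begin
  (+ 6 / 1 * x ^ 3 * u) ^ 4                 ≡⟨ expand x u ⟩
  + 1296 / 1 * (x ^ 4) ^ 3 * u ^ 4          ≤⟨ *-monoʳ-≤-nonNeg (u ^ 4) {{nonNegative (0≤^ 4 (0≤inv k))}}
                                                 (*-monoˡ-≤-nonNeg (+ 1296 / 1)
                                                   (^-monoˡ-≤-nonNeg 3 (0≤^ 4 0≤x) ([1+H]⁴≤512n k))) ⟩
  + 1296 / 1 * (C * n) ^ 3 * u ^ 4          ≡⟨ regroup C n u ⟩
  + 1296 / 1 * C ^ 3 * (u * n) ^ 3 * u      ≡⟨ cong (λ t → + 1296 / 1 * C ^ 3 * t ^ 3 * u) (inv-*-fromℕ k) ⟩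
  + 1296 / 1 * C ^ 3 * 1ℚ ^ 3 * u           ≡⟨ drop-one (+ 1296 / 1 * C ^ 3) u ⟩
  + 1296 / 1 * C ^ 3 * u                    ∎
  where
  open ≤-Reasoning
  x u n C : ℚ
  x = 1ℚ + H (suc k)
  u = inv k
  n = fromℕ (suc k)
  C = + 512 / 1
  0≤x : 0ℚ ≤ x
  0≤x = 0≤+ (0≤fromℕ 1) (H^-nonNeg 1 (suc k))
  expand : ∀ x u → (+ 6 / 1 * x ^ 3 * u) ^ 4 ≡ + 1296 / 1 * (x ^ 4) ^ 3 * u ^ 4
  expand = solve-∀ ℚ-ring
  regroup : ∀ C n u → + 1296 / 1 * (C * n) ^ 3 * u ^ 4 ≡ + 1296 / 1 * C ^ 3 * (u * n) ^ 3 * u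
  regroup = solve-∀ ℚ-ring
  drop-one : ∀ K u → K * 1ℚ ^ 3 * u ≡ K * u
  drop-one = solve-∀ ℚ-ring

IsNull-majorant : IsNull majorant
IsNull-majorant = IsNull-of-^-bound 4 (+ 1296 / 1 * (+ 512 / 1) ^ 3) majorant⁴≤

corollary2p4 : SeriesConvergesTo term₁ ((+ (3 !)) / 1) × SeriesConvergesTo term₂ ((+ (4 !)) / 1)
corollary2p4 =
    series-converges-of-tail tail₁-step 0≤tail₁
      (IsNull-≤ (λ k → ≤-trans (tail₁≤tail₂ k) (tail₂≤majorant k)) IsNull-majorant)
  , series-converges-of-tail tail₂-step 0≤tail₂ (IsNull-≤ tail₂≤majorant IsNull-majorant)
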